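{- As formal power series, \[ B^{(\mathrm{pk},\mathrm{des})}\Big(xt,\,y,\,\frac1t\Big)\,B^{(\mathrm{pk},\mathrm{des})}(x,y,t)=(1+t)\,P^{(\mathrm{pk},\mathrm{des})}(x,y,t)-t . \]
   Context: For $\pi=\pi_1\cdots\pi_n\in\mathcal S_n$, $\operatorname{des}(\pi)$ ($\operatorname{asc}(\pi)$) is the number of positions $1\le i\le n-1$ with $\pi_i>\pi_{i+1}$ ($\pi_i<\pi_{i+1}$), and $\operatorname{pk}(\pi)$ the number of positions $2\le i\le n-1$ with $\pi_{i-1}<\pi_i>\pi_{i+1}$. $\pi$ is a ballot permutation if $\operatorname{asc}(\pi_1\cdots\pi_i)\ge\operatorname{des}(\pi_1\cdots\pi_i)$ for all $i$; $\mathscr B_n$ denotes the set of ballot permutations of $[n]$, and $\mathscr B_0=\mathcal S_0=\{\epsilon\}$ with the empty permutation having all statistics $0$. Define $P^{(\mathrm{pk},\mathrm{des})}(x,y,t)=\sum_{n\ge0}\sum_{\pi\in\mathcal S_n} y^{\operatorname{pk}(\pi)}t^{\operatorname{des}(\pi)}\frac{x^n}{n!}$ and $B^{(\mathrm{pk},\mathrm{des})}(x,y,t)=\sum_{n\ge0}\sum_{\pi\in\mathscr B_n} y^{\operatorname{pk}(\pi)}t^{\operatorname{des}(\pi)}\frac{x^n}{n!}$. -}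

module Defs where

open import Level using (Level)
open import Data.Nat as ℕ using (ℕ; zero; suc; _∸_; _<ᵇ_; _≤ᵇ_)
open import Data.Nat.Combinatorics using (_C_)
open import Data.Bool using (Bool; true; false; if_then_else_; _∧_)
open import Data.List using (List; []; _∷_; map; concatMap; take; length; upTo)
open import Algebra.Bundles using (CommutativeRing)

-- Permutations of [n] = {1,…,n}, as words π₁⋯πₙ (lists).

insertions : ℕ → List ℕ → List (List ℕ)
insertions x []       = (x ∷ []) ∷ []
insertions x (y ∷ ys) = (x ∷ y ∷ ys) ∷ map (y ∷_) (insertions x ys)

-- perms n enumerates S_n (each permutation exactly once):
-- every permutation of [n+1] arises uniquely by inserting n+1 into
-- a permutation of [n].
perms : ℕ → List (List ℕ)
perms zero    = [] ∷ []
perms (suc n) = concatMap (insertions (suc n)) (perms n)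

des : List ℕ → ℕ
des (a ∷ b ∷ r) = (if b <ᵇ a then 1 else 0) ℕ.+ des (b ∷ r)
des _           = 0

asc : List ℕ → ℕ
asc (a ∷ b ∷ r) = (if a <ᵇ b then 1 else 0) ℕ.+ asc (b ∷ r)
asc _           = 0

pk : List ℕ → ℕ
pk (a ∷ b ∷ c ∷ r) = (if (a <ᵇ b) ∧ (c <ᵇ b) then 1 else 0) ℕ.+ pk (b ∷ c ∷ r)
pk _               = 0

allB : {A : Set} → (A → Bool) → List A → Bool
allB p []       = true
allB p (x ∷ xs) = p x ∧ allB p xs

isBallot : List ℕ → Bool
isBallot π = allB (λ i → des (take i π) ≤ᵇ asc (take i π)) (upTo (suc (length π)))

-- Coefficient sequences (formal power series in x, coefficients in a
-- commutative ring R; y, t are elements of R).  A series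
-- Σ aₙ xⁿ/n! is represented by its sequence n ↦ aₙ.

module _ {c ℓ : Level} (R : CommutativeRing c ℓ) where
  open CommutativeRing R

  Series : Set c
  Series = ℕ → Carrier

  pow : Carrier → ℕ → Carrier
  pow a zero    = 1#
  pow a (suc n) = a * pow a n

  natR : ℕ → Carrier
  natR zero    = 0#
  natR (suc n) = 1# + natR n

  sumL : List Carrier → Carrier
  sumL []       = 0#
  sumL (a ∷ as) = a + sumL as

  weight : Carrier → Carrier → List ℕ → Carrier
  weight y t π = pow y (pk π) * pow t (des π)

  Pser : Carrier → Carrier → Series
  Pser y t n = sumL (map (weight y t) (perms n))

  Bser : Carrier → Carrier → Series
  Bser y t n = sumL (map (λ π → if isBallot π then weight y t π else 0#) (perms n))

  -- substitution x ↦ x·s : coefficient of xⁿ/n! gets multiplied by sⁿ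
  scaleX : Carrier → Series → Series
  scaleX s f n = pow s n * f n

  -- product of exponential generating functions (binomial convolution)
  _*ₑ_ : Series → Series → Series
  (f *ₑ g) n = sumL (map (λ k → natR (n C k) * (f k * g (n ∸ k))) (upTo (suc n)))

  constS : Carrier → Series
  constS a zero    = a
  constS a (suc n) = 0#

  _·ₛ_ : Carrier → Series → Series
  (a ·ₛ f) n = a * f n

  _-ₛ_ : Series → Series → Series
  (f -ₛ g) n = f n - g n

module Submission where

-- Every statistic involved is a function of the up–down word of 0 π 0 (the frame of π), and
-- inserting the maximum n + 1 into π replaces one letter of the frame by an ascent followed by a
-- descent.  So h ↦ (n ↦ Σ_{π ∈ S_n} h (frame π)) sends the derivative "insert a peak" on word
-- functions to the derivative of exponential generating functions, and it turns the binomial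
-- convolution of two such series into a sum over the cuts π = π′π″ of a single permutation.
-- By the reverse–complement symmetry the left factor B(xt, y, 1/t) counts prefixes π′ whose
-- mirror is ballot, i.e. on which the walk (ascent +1, descent −1, descents at 0 absorbed) ends
-- at 0.  For a fixed π exactly one cut then has weight y^pk t^des (at the last absorbed
-- descent, or at the front if π is ballot) and exactly one has weight t y^pk t^des (at the last
-- visit of the walk to 0), which gives (1 + t) P; the empty permutation accounts for − t.

open import Defs
open import Algebra.Bundles using (CommutativeRing)
open import Data.Bool using (Bool; true; false; not; _∧_; if_then_else_)
open import Data.Bool.Properties using (not-involutive)
open import Data.Empty using (⊥-elim)
open import Data.List
  using (List; []; _∷_; _++_; _∷ʳ_; initLast; _∷ʳ′_; map; concatMap; reverse; length; take; foldl; upTo; applyUpTo)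
open import Data.List.Properties
  using ( map-∘; map-++; ++-assoc; ++-identityʳ; ∷ʳ-++; length-++; length-reverse; length-map
        ; reverse-++; reverse-map; reverse-involutive; unfold-reverse; foldl-∷ʳ; map-applyUpTo)
open import Data.List.Relation.Unary.All as All using (All; []; _∷_)
open import Data.List.Relation.Unary.All.Properties using (map⁺; concat⁺)
open import Data.List.Relation.Unary.Linked using (Linked; []; [-]; _∷_)
open import Data.Nat as ℕ using (ℕ; zero; suc; _<_; _∸_; _<ᵇ_; _≤ᵇ_; z<s; s<s)
open import Data.Nat.Properties as ℕ
  using (<ᵇ-reflects-<; <-asym; ≤-antisym; ≮⇒≥; <⇒≢; >⇒≢; n<1+n; m<n⇒m<1+n; +-∸-assoc)
open import Data.Nat.Combinatorics using (_C_; nCk+nC[k+1]≡[n+1]C[k+1]; k>n⇒nCk≡0)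
open import Data.Product using (_×_; _,_)
open import Function using (_∘_; id)
open import Relation.Nullary.Reflects using (ofʸ; ofⁿ)
open import Relation.Binary.PropositionalEquality as ≡ using (_≡_; _≢_; refl; cong; cong₂)

-- Up–down words: true is an ascent, false a descent.

peakInsertions : List Bool → List (List Bool)
peakInsertions []      = []
peakInsertions (x ∷ w) = (true ∷ false ∷ w) ∷ map (x ∷_) (peakInsertions w)

mirror : List Bool → List Bool
mirror w = reverse (map not w)

dropLast : ∀ {A : Set} → List A → List A
dropLast []          = []
dropLast (x ∷ [])    = []
dropLast (x ∷ y ∷ w) = x ∷ dropLast (y ∷ w)

suffixFrame : List Bool → List Bool
suffixFrame []      = false ∷ []
suffixFrame (x ∷ w) = true ∷ x ∷ w

downs : List Bool → ℕ
downs []          = 0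
downs (true ∷ w)  = downs w
downs (false ∷ w) = suc (downs w)

ups : List Bool → ℕ
ups []          = 0
ups (true ∷ w)  = suc (ups w)
ups (false ∷ w) = ups w

peaksAfter : Bool → List Bool → ℕ
peaksAfter _     []          = 0
peaksAfter true  (false ∷ w) = suc (peaksAfter false w)
peaksAfter true  (true ∷ w)  = peaksAfter true w
peaksAfter false (x ∷ w)     = peaksAfter x w

peaks : List Bool → ℕ
peaks = peaksAfter false

lastOr : Bool → List Bool → Bool
lastOr x []      = x
lastOr _ (y ∷ w) = lastOr y w

ballot : ℕ → List Bool → Bool
ballot h       []          = true
ballot h       (true ∷ w)  = ballot (suc h) w
ballot zero    (false ∷ w) = false
ballot (suc h) (false ∷ w) = ballot h w

touchesZero : ℕ → List Bool → Bool
touchesZero zero    w = true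
touchesZero (suc h) w = not (ballot h w)

climb : ℕ → Bool → ℕ
climb h true  = suc h
climb h false = ℕ.pred h

-- The walk from 0 along w in which a descent at height 0 stays at 0.
height : List Bool → ℕ
height = foldl climb 0

module _ where
  open ≡.≡-Reasoning

  mirror-∷ : ∀ x w → mirror (x ∷ w) ≡ mirror w ∷ʳ not x
  mirror-∷ x w = unfold-reverse (not x) (map not w)

  mirror-∷ʳ : ∀ w x → mirror (w ∷ʳ x) ≡ not x ∷ mirror w
  mirror-∷ʳ w x = ≡.trans (cong reverse (map-++ not w (x ∷ []))) (reverse-++ (map not w) (not x ∷ []))

  mirror-involutive : ∀ w → mirror (mirror w) ≡ w
  mirror-involutive w = begin
    reverse (map not (reverse (map not w))) ≡⟨ cong reverse (reverse-map not (map not w)) ⟩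
    reverse (reverse (map not (map not w))) ≡⟨ reverse-involutive (map not (map not w)) ⟩
    map not (map not w)                     ≡⟨ map-not-not w ⟩
    w                                       ∎
    where
    map-not-not : ∀ w → map not (map not w) ≡ w
    map-not-not []      = refl
    map-not-not (x ∷ w) = cong₂ _∷_ (not-involutive x) (map-not-not w)

  peakInsertions-∷ʳ : ∀ w x →
    peakInsertions (w ∷ʳ x) ≡ map (_∷ʳ x) (peakInsertions w) ∷ʳ (w ++ true ∷ false ∷ [])
  peakInsertions-∷ʳ []      x = refl
  peakInsertions-∷ʳ (y ∷ w) x = cong ((true ∷ false ∷ w ∷ʳ x) ∷_) (begin
    map (y ∷_) (peakInsertions (w ∷ʳ x))
      ≡⟨ cong (map (y ∷_)) (peakInsertions-∷ʳ w x) ⟩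
    map (y ∷_) (map (_∷ʳ x) (peakInsertions w) ∷ʳ (w ++ true ∷ false ∷ []))
      ≡⟨ map-++ (y ∷_) (map (_∷ʳ x) (peakInsertions w)) _ ⟩
    map (y ∷_) (map (_∷ʳ x) (peakInsertions w)) ∷ʳ (y ∷ w ++ true ∷ false ∷ [])
      ≡⟨ cong (_∷ʳ (y ∷ w ++ true ∷ false ∷ []))
              (≡.trans (≡.sym (map-∘ (peakInsertions w))) (map-∘ (peakInsertions w))) ⟩
    map (_∷ʳ x) (map (y ∷_) (peakInsertions w)) ∷ʳ (y ∷ w ++ true ∷ false ∷ []) ∎)

  map-mirror-peakInsertions : ∀ w → map mirror (peakInsertions w) ≡ reverse (peakInsertions (mirror w))
  map-mirror-peakInsertions []      = refl
  map-mirror-peakInsertions (x ∷ w) = begin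
    mirror (true ∷ false ∷ w) ∷ map mirror (map (x ∷_) (peakInsertions w))
      ≡⟨ cong₂ _∷_ mirror-↑↓ (map-mirror-∷ (peakInsertions w)) ⟩
    (mirror w ++ true ∷ false ∷ []) ∷ map (_∷ʳ not x) (map mirror (peakInsertions w))
      ≡⟨ cong (λ ws → (mirror w ++ true ∷ false ∷ []) ∷ map (_∷ʳ not x) ws) (map-mirror-peakInsertions w) ⟩
    (mirror w ++ true ∷ false ∷ []) ∷ map (_∷ʳ not x) (reverse (peakInsertions (mirror w)))
      ≡⟨ cong ((mirror w ++ true ∷ false ∷ []) ∷_) (reverse-map (_∷ʳ not x) (peakInsertions (mirror w))) ⟩
    (mirror w ++ true ∷ false ∷ []) ∷ reverse (map (_∷ʳ not x) (peakInsertions (mirror w)))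
      ≡⟨ reverse-++ (map (_∷ʳ not x) (peakInsertions (mirror w))) _ ⟨
    reverse (map (_∷ʳ not x) (peakInsertions (mirror w)) ∷ʳ (mirror w ++ true ∷ false ∷ []))
      ≡⟨ cong reverse (peakInsertions-∷ʳ (mirror w) (not x)) ⟨
    reverse (peakInsertions (mirror w ∷ʳ not x))
      ≡⟨ cong (reverse ∘ peakInsertions) (mirror-∷ x w) ⟨
    reverse (peakInsertions (mirror (x ∷ w))) ∎
    where
    mirror-↑↓ : mirror (true ∷ false ∷ w) ≡ mirror w ++ true ∷ false ∷ []
    mirror-↑↓ = begin
      mirror (true ∷ false ∷ w)         ≡⟨ mirror-∷ true (false ∷ w) ⟩
      mirror (false ∷ w) ∷ʳ false       ≡⟨ cong (_∷ʳ false) (mirror-∷ false w) ⟩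
      (mirror w ∷ʳ true) ∷ʳ false       ≡⟨ ++-assoc (mirror w) (true ∷ []) (false ∷ []) ⟩
      mirror w ++ true ∷ false ∷ []     ∎
    map-mirror-∷ : ∀ ws → map mirror (map (x ∷_) ws) ≡ map (_∷ʳ not x) (map mirror ws)
    map-mirror-∷ []       = refl
    map-mirror-∷ (v ∷ ws) = cong₂ _∷_ (mirror-∷ x v) (map-mirror-∷ ws)

  peakInsertions-suffixFrame : ∀ w →
    peakInsertions (suffixFrame w) ≡ suffixFrame (false ∷ w) ∷ map suffixFrame (peakInsertions w)
  peakInsertions-suffixFrame []      = refl
  peakInsertions-suffixFrame (a ∷ w) = cong (λ ws → (true ∷ false ∷ a ∷ w) ∷ (true ∷ true ∷ false ∷ w) ∷ ws) (begin
    map (true ∷_) (map (a ∷_) (peakInsertions w))        ≡⟨ map-∘ (peakInsertions w) ⟨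
    map (suffixFrame ∘ (a ∷_)) (peakInsertions w)        ≡⟨ map-∘ (peakInsertions w) ⟩
    map suffixFrame (map (a ∷_) (peakInsertions w))      ∎)

  dropLast-∷ʳ : ∀ {A : Set} (w : List A) x → dropLast (w ∷ʳ x) ≡ w
  dropLast-∷ʳ []          x = refl
  dropLast-∷ʳ (y ∷ [])    x = refl
  dropLast-∷ʳ (y ∷ z ∷ w) x = cong (y ∷_) (dropLast-∷ʳ (z ∷ w) x)

  suffixFrame-∷ʳ : ∀ w x → suffixFrame (w ∷ʳ x) ≡ true ∷ w ∷ʳ x
  suffixFrame-∷ʳ []      x = refl
  suffixFrame-∷ʳ (y ∷ w) x = refl

  length-∷ʳ : ∀ {A : Set} (w : List A) x → length (w ∷ʳ x) ≡ suc (length w)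
  length-∷ʳ w x = ≡.trans (length-++ w) (ℕ.+-comm (length w) 1)

  length≡ups+downs : ∀ w → length w ≡ ups w ℕ.+ downs w
  length≡ups+downs []          = refl
  length≡ups+downs (true ∷ w)  = cong suc (length≡ups+downs w)
  length≡ups+downs (false ∷ w) = ≡.trans (cong suc (length≡ups+downs w)) (≡.sym (ℕ.+-suc (ups w) (downs w)))

  downs-++ : ∀ u v → downs (u ++ v) ≡ downs u ℕ.+ downs v
  downs-++ []          v = refl
  downs-++ (true ∷ u)  v = downs-++ u v
  downs-++ (false ∷ u) v = cong suc (downs-++ u v)

  downs-mirror : ∀ w → downs (mirror w) ≡ ups w
  downs-mirror []      = refl
  downs-mirror (x ∷ w) = ≡.trans (cong downs (mirror-∷ x w)) (≡.trans (downs-++ (mirror w) (not x ∷ [])) (last x))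
    where
    last : ∀ x → downs (mirror w) ℕ.+ downs (not x ∷ []) ≡ ups (x ∷ w)
    last true  = ≡.trans (ℕ.+-comm (downs (mirror w)) 1) (cong suc (downs-mirror w))
    last false = ≡.trans (ℕ.+-identityʳ (downs (mirror w))) (downs-mirror w)

  peaksAfter-∷ : ∀ x y w → peaksAfter x (y ∷ w) ≡ (if x ∧ not y then 1 else 0) ℕ.+ peaksAfter y w
  peaksAfter-∷ true  true  w = refl
  peaksAfter-∷ true  false w = refl
  peaksAfter-∷ false y     w = refl

  peaksAfter-++ : ∀ x u v → peaksAfter x (u ++ v) ≡ peaksAfter x u ℕ.+ peaksAfter (lastOr x u) v
  peaksAfter-++ x []      v = refl
  peaksAfter-++ x (y ∷ u) v = begin
    peaksAfter x (y ∷ u ++ v)                                           ≡⟨ peaksAfter-∷ x y (u ++ v) ⟩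
    (if x ∧ not y then 1 else 0) ℕ.+ peaksAfter y (u ++ v)              ≡⟨ cong (_ ℕ.+_) (peaksAfter-++ y u v) ⟩
    (if x ∧ not y then 1 else 0) ℕ.+ (peaksAfter y u ℕ.+ peaksAfter (lastOr y u) v)
      ≡⟨ ℕ.+-assoc (if x ∧ not y then 1 else 0) _ _ ⟨
    ((if x ∧ not y then 1 else 0) ℕ.+ peaksAfter y u) ℕ.+ peaksAfter (lastOr y u) v
      ≡⟨ cong (ℕ._+ _) (peaksAfter-∷ x y u) ⟨
    peaksAfter x (y ∷ u) ℕ.+ peaksAfter (lastOr y u) v                  ∎

  lastOr-∷ʳ : ∀ x w y → lastOr x (w ∷ʳ y) ≡ y
  lastOr-∷ʳ x []      y = refl
  lastOr-∷ʳ x (z ∷ w) y = lastOr-∷ʳ z w y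

  peaks-mirror : ∀ w → peaks (mirror w) ≡ peaks w
  peaks-mirror []          = refl
  peaks-mirror (x ∷ [])    = refl
  peaks-mirror (x ∷ y ∷ w) = begin
    peaks (mirror (x ∷ y ∷ w))                                    ≡⟨ cong peaks (mirror-∷ x (y ∷ w)) ⟩
    peaks (mirror (y ∷ w) ∷ʳ not x)                               ≡⟨ peaksAfter-++ false (mirror (y ∷ w)) (not x ∷ []) ⟩
    peaks (mirror (y ∷ w)) ℕ.+ peaksAfter (lastOr false (mirror (y ∷ w))) (not x ∷ [])
      ≡⟨ cong (λ z → peaks (mirror (y ∷ w)) ℕ.+ peaksAfter (lastOr false z) (not x ∷ [])) (mirror-∷ y w) ⟩
    peaks (mirror (y ∷ w)) ℕ.+ peaksAfter (lastOr false (mirror w ∷ʳ not y)) (not x ∷ [])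
      ≡⟨ cong₂ (λ m z → m ℕ.+ peaksAfter z (not x ∷ [])) (peaks-mirror (y ∷ w)) (lastOr-∷ʳ false (mirror w) (not y)) ⟩
    peaks (y ∷ w) ℕ.+ peaksAfter (not y) (not x ∷ [])             ≡⟨ cong (peaks (y ∷ w) ℕ.+_) (peak-at x y) ⟩
    peaks (y ∷ w) ℕ.+ (if x ∧ not y then 1 else 0)                ≡⟨ ℕ.+-comm (peaks (y ∷ w)) _ ⟩
    (if x ∧ not y then 1 else 0) ℕ.+ peaks (y ∷ w)                ≡⟨ peaksAfter-∷ x y w ⟨
    peaks (x ∷ y ∷ w)                                             ∎
    where
    peak-at : ∀ x y → peaksAfter (not y) (not x ∷ []) ≡ (if x ∧ not y then 1 else 0)
    peak-at true  true  = refl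
    peak-at true  false = refl
    peak-at false true  = refl
    peak-at false false = refl

  height-∷ʳ : ∀ w x → height (w ∷ʳ x) ≡ climb (height w) x
  height-∷ʳ w x = foldl-∷ʳ climb 0 x w

  height≡0⇒lastOr≡false : ∀ w → height w ≡ 0 → lastOr false w ≡ false
  height≡0⇒lastOr≡false w h≡0 with initLast w
  ... | []            = refl
  ... | u ∷ʳ′ false   = lastOr-∷ʳ false u false
  ... | u ∷ʳ′ true    with () ← ≡.trans (≡.sym (height-∷ʳ u true)) h≡0

  ≤ᵇ≡<ᵇsuc : ∀ m n → (m ≤ᵇ n) ≡ (m <ᵇ suc n)
  ≤ᵇ≡<ᵇsuc zero    n = refl
  ≤ᵇ≡<ᵇsuc (suc m) n = refl

  ballot≡height-mirror≤ᵇ : ∀ h w → ballot h w ≡ (height (mirror w) ≤ᵇ h)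
  ballot≡height-mirror≤ᵇ h []          = refl
  ballot≡height-mirror≤ᵇ h (true ∷ w)
    rewrite mirror-∷ true w | height-∷ʳ (mirror w) false
    = ≡.trans (ballot≡height-mirror≤ᵇ (suc h) w) (pred-≤ᵇ (height (mirror w)))
    where
    pred-≤ᵇ : ∀ m → (m ≤ᵇ suc h) ≡ (ℕ.pred m ≤ᵇ h)
    pred-≤ᵇ zero    = refl
    pred-≤ᵇ (suc m) = ≡.sym (≤ᵇ≡<ᵇsuc m h)
  ballot≡height-mirror≤ᵇ zero    (false ∷ w)
    rewrite mirror-∷ false w | height-∷ʳ (mirror w) true = refl
  ballot≡height-mirror≤ᵇ (suc h) (false ∷ w)
    rewrite mirror-∷ false w | height-∷ʳ (mirror w) true
    = ≡.trans (ballot≡height-mirror≤ᵇ h w) (≤ᵇ≡<ᵇsuc (height (mirror w)) h)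

  ballot-mirror : ∀ h w → ballot h (mirror w) ≡ (height w ≤ᵇ h)
  ballot-mirror h w = ≡.trans (ballot≡height-mirror≤ᵇ h (mirror w)) (cong (λ v → height v ≤ᵇ h) (mirror-involutive w))

  peaks-++-grounded : ∀ p v → height p ≡ 0 → peaks (p ++ v) ≡ peaks p ℕ.+ peaks v
  peaks-++-grounded p v h≡0 =
    ≡.trans (peaksAfter-++ false p v) (cong (λ x → peaks p ℕ.+ peaksAfter x v) (height≡0⇒lastOr≡false p h≡0))

  peaks-↑∷ballot : ∀ s → ballot 0 s ≡ true → peaks (true ∷ s) ≡ peaks s
  peaks-↑∷ballot []          _  = refl
  peaks-↑∷ballot (true ∷ s)  _  = refl
  peaks-↑∷ballot (false ∷ s) ()

steps : ℕ → List ℕ → List Bool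
steps p []      = []
steps p (a ∷ σ) = (p <ᵇ a) ∷ steps a σ

-- frame σ is the up–down word of 0 σ₁ ⋯ σₖ 0.
frame : List ℕ → List Bool
frame σ = steps 0 σ ∷ʳ false

<ᵇ-flip : ∀ {a b} → a ≢ b → (b <ᵇ a) ≡ not (a <ᵇ b)
<ᵇ-flip {a} {b} a≢b with a <ᵇ b | <ᵇ-reflects-< a b | b <ᵇ a | <ᵇ-reflects-< b a
... | true  | ofʸ a<b | true  | ofʸ b<a = ⊥-elim (<-asym a<b b<a)
... | true  | _       | false | _       = refl
... | false | _       | true  | _       = refl
... | false | ofⁿ a≮b | false | ofⁿ b≮a = ⊥-elim (a≢b (≤-antisym (≮⇒≥ b≮a) (≮⇒≥ a≮b)))

<ᵇ-true : ∀ {m n} → m < n → (m <ᵇ n) ≡ true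
<ᵇ-true {m} {n} m<n with m <ᵇ n | <ᵇ-reflects-< m n
... | true  | _        = refl
... | false | ofⁿ m≮n = ⊥-elim (m≮n m<n)

<ᵇ-false : ∀ {m n} → n < m → (m <ᵇ n) ≡ false
<ᵇ-false {m} {n} n<m with m <ᵇ n | <ᵇ-reflects-< m n
... | true  | ofʸ m<n = ⊥-elim (<-asym m<n n<m)
... | false | _       = refl

length-steps : ∀ p σ → length (steps p σ) ≡ length σ
length-steps p []      = refl
length-steps p (a ∷ σ) = cong suc (length-steps a σ)

des-steps : ∀ {a σ} → Linked _≢_ (a ∷ σ) → des (a ∷ σ) ≡ downs (steps a σ)
des-steps [-] = refl
des-steps {a} {b ∷ σ} (a≢b ∷ linked) rewrite <ᵇ-flip a≢b with a <ᵇ b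
... | true  = des-steps linked
... | false = cong suc (des-steps linked)

pk-steps : ∀ {a σ} → Linked _≢_ (a ∷ σ) → pk (a ∷ σ) ≡ peaks (steps a σ)
pk-steps [-]       = refl
pk-steps (_ ∷ [-]) = refl
pk-steps {a} {b ∷ c ∷ σ} (_ ∷ linked@(b≢c ∷ _)) =
  ≡.trans (cong₂ (λ x n → (if (a <ᵇ b) ∧ x then 1 else 0) ℕ.+ n) (<ᵇ-flip b≢c) (pk-steps linked))
          (≡.sym (peaksAfter-∷ (a <ᵇ b) (b <ᵇ c) (steps c σ)))

allB-cong : ∀ {A : Set} {P Q : A → Bool} → (∀ x → P x ≡ Q x) → ∀ xs → allB P xs ≡ allB Q xs
allB-cong P≗Q []       = refl
allB-cong P≗Q (x ∷ xs) = cong₂ _∧_ (P≗Q x) (allB-cong P≗Q xs)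

allB-upTo-suc : ∀ (P : ℕ → Bool) n → allB P (upTo (suc n)) ≡ P 0 ∧ allB (P ∘ suc) (upTo n)
allB-upTo-suc P n = cong (P 0 ∧_) (≡.trans (cong (allB P) (≡.sym (map-applyUpTo id suc n))) (allB-map (upTo n)))
  where
  allB-map : ∀ xs → allB P (map suc xs) ≡ allB (P ∘ suc) xs
  allB-map []       = refl
  allB-map (x ∷ xs) = cong (P (suc x) ∧_) (allB-map xs)

-- isBallot = ballotFrom 0; the slack h is needed for the induction along σ.
ballotFrom : ℕ → List ℕ → Bool
ballotFrom h π = allB (λ i → des (take i π) ≤ᵇ h ℕ.+ asc (take i π)) (upTo (suc (length π)))

ballotFrom-∷ : ∀ h b σ →
  ballotFrom h (b ∷ σ) ≡ allB (λ i → des (b ∷ take i σ) ≤ᵇ h ℕ.+ asc (b ∷ take i σ)) (upTo (suc (length σ)))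
ballotFrom-∷ h b σ = allB-upTo-suc (λ i → des (take i (b ∷ σ)) ≤ᵇ h ℕ.+ asc (take i (b ∷ σ))) (suc (length σ))

ballotFrom-∷∷ : ∀ h a b σ →
  ballotFrom h (a ∷ b ∷ σ)
    ≡ allB (λ i → des (a ∷ b ∷ take i σ) ≤ᵇ h ℕ.+ asc (a ∷ b ∷ take i σ)) (upTo (suc (length σ)))
ballotFrom-∷∷ h a b σ = ≡.trans (allB-upTo-suc P (suc (suc (length σ)))) (allB-upTo-suc (P ∘ suc) (suc (length σ)))
  where
  P : ℕ → Bool
  P i = des (take i (a ∷ b ∷ σ)) ≤ᵇ h ℕ.+ asc (take i (a ∷ b ∷ σ))

ballotFrom-steps : ∀ h {a σ} → Linked _≢_ (a ∷ σ) → ballotFrom h (a ∷ σ) ≡ ballot h (steps a σ)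
ballotFrom-steps h [-] = refl
ballotFrom-steps h {a} {b ∷ σ} (a≢b ∷ linked) = ≡.trans (ballotFrom-∷∷ h a b σ) (first-step h (<ᵇ-flip a≢b))
  where
  D A : ℕ → ℕ
  D i = des (b ∷ take i σ)
  A i = asc (b ∷ take i σ)
  first-step : ∀ h → (b <ᵇ a) ≡ not (a <ᵇ b) →
    allB (λ i → des (a ∷ b ∷ take i σ) ≤ᵇ h ℕ.+ asc (a ∷ b ∷ take i σ)) (upTo (suc (length σ)))
      ≡ ballot h ((a <ᵇ b) ∷ steps b σ)
  first-step h flip rewrite flip with a <ᵇ b
  ... | true = begin
    allB (λ i → D i ≤ᵇ h ℕ.+ suc (A i)) (upTo (suc (length σ)))
      ≡⟨ allB-cong (λ i → cong (D i ≤ᵇ_) (ℕ.+-suc h (A i))) (upTo (suc (length σ))) ⟩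
    allB (λ i → D i ≤ᵇ suc h ℕ.+ A i) (upTo (suc (length σ)))   ≡⟨ ballotFrom-∷ (suc h) b σ ⟨
    ballotFrom (suc h) (b ∷ σ)                                  ≡⟨ ballotFrom-steps (suc h) linked ⟩
    ballot (suc h) (steps b σ)                                  ∎
    where open ≡.≡-Reasoning
  first-step zero    flip | false = refl
  first-step (suc h) flip | false = begin
    allB (λ i → suc (D i) ≤ᵇ suc (h ℕ.+ A i)) (upTo (suc (length σ)))
      ≡⟨ allB-cong (λ i → ≤ᵇ≡<ᵇsuc (D i) (h ℕ.+ A i)) (upTo (suc (length σ))) ⟨
    allB (λ i → D i ≤ᵇ h ℕ.+ A i) (upTo (suc (length σ)))             ≡⟨ ballotFrom-∷ h b σ ⟨
    ballotFrom h (b ∷ σ)                                              ≡⟨ ballotFrom-steps h linked ⟩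
    ballot h (steps b σ)                                              ∎
    where open ≡.≡-Reasoning

isBallot-steps : ∀ {a σ} → Linked _≢_ (a ∷ σ) → isBallot (a ∷ σ) ≡ ballot 0 (steps a σ)
isBallot-steps = ballotFrom-steps 0

steps-insertions : ∀ {c p α} → p < c → All (_< c) α →
  map (λ π → steps p π ∷ʳ false) (insertions c α) ≡ peakInsertions (steps p α ∷ʳ false)
steps-insertions p<c [] rewrite <ᵇ-true p<c = refl
steps-insertions {c} {p} {a ∷ α} p<c (a<c ∷ α<c) rewrite <ᵇ-true p<c | <ᵇ-false a<c =
  cong ((true ∷ false ∷ steps a α ∷ʳ false) ∷_) (begin
    map (λ π → steps p π ∷ʳ false) (map (a ∷_) (insertions c α))         ≡⟨ map-∘ (insertions c α) ⟨
    map (((p <ᵇ a) ∷_) ∘ (λ π → steps a π ∷ʳ false)) (insertions c α)    ≡⟨ map-∘ (insertions c α) ⟩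
    map ((p <ᵇ a) ∷_) (map (λ π → steps a π ∷ʳ false) (insertions c α))
      ≡⟨ cong (map ((p <ᵇ a) ∷_)) (steps-insertions a<c α<c) ⟩
    map ((p <ᵇ a) ∷_) (peakInsertions (steps a α ∷ʳ false))              ∎)
  where open ≡.≡-Reasoning

frame-insertions : ∀ {k σ} → All (_< suc k) σ → map frame (insertions (suc k) σ) ≡ peakInsertions (frame σ)
frame-insertions = steps-insertions z<s

length-insertions : ∀ c α → All (λ π → length π ≡ suc (length α)) (insertions c α)
length-insertions c []      = refl ∷ []
length-insertions c (a ∷ α) = refl ∷ map⁺ (All.map (cong suc) (length-insertions c α))

insertions-bounded : ∀ {c α} → All (_< c) α → All (All (_< suc c)) (insertions c α)
insertions-bounded {c} []            = (n<1+n c ∷ []) ∷ []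
insertions-bounded {c} (a<c ∷ α<c) =
  (n<1+n c ∷ m<n⇒m<1+n a<c ∷ All.map m<n⇒m<1+n α<c) ∷ map⁺ (All.map (m<n⇒m<1+n a<c ∷_) (insertions-bounded α<c))

insertions-linked∷ : ∀ {c p α} → p < c → All (_< c) α → Linked _≢_ (p ∷ α) →
  All (λ π → Linked _≢_ (p ∷ π)) (insertions c α)
insertions-linked∷ p<c []          [-]          = (<⇒≢ p<c ∷ [-]) ∷ []
insertions-linked∷ p<c (a<c ∷ α<c) (p≢a ∷ linked) =
  (<⇒≢ p<c ∷ >⇒≢ a<c ∷ linked) ∷ map⁺ (All.map (p≢a ∷_) (insertions-linked∷ a<c α<c linked))

insertions-linked : ∀ {c α} → All (_< c) α → Linked _≢_ α → All (Linked _≢_) (insertions c α)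
insertions-linked []          []     = [-] ∷ []
insertions-linked (a<c ∷ α<c) linked = (>⇒≢ a<c ∷ linked) ∷ map⁺ (insertions-linked∷ a<c α<c linked)

WellFormed : ℕ → List ℕ → Set
WellFormed k σ = length σ ≡ k × All (_< suc k) σ × Linked _≢_ σ

insertions-wellFormed : ∀ {k σ} → WellFormed k σ → All (WellFormed (suc k)) (insertions (suc k) σ)
insertions-wellFormed {σ = σ} (refl , bounded , linked) =
  All.zip (length-insertions _ σ , All.zip (insertions-bounded bounded , insertions-linked bounded linked))

perms-wellFormed : ∀ k → All (WellFormed k) (perms k)
perms-wellFormed zero    = (refl , [] , []) ∷ []
perms-wellFormed (suc k) = concat⁺ (map⁺ (All.map insertions-wellFormed (perms-wellFormed k)))

module Sums {c ℓ} (R : CommutativeRing c ℓ) where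
  open CommutativeRing R renaming (refl to ≈-refl)
  open import Relation.Binary.Reasoning.Setoid setoid
  open import Algebra.Properties.CommutativeSemigroup +-commutativeSemigroup using (interchange)

  ∑ : List Carrier → Carrier
  ∑ = sumL R

  ≡⇒≈ : ∀ {a b} → a ≡ b → a ≈ b
  ≡⇒≈ refl = ≈-refl

  sumL-++ : ∀ xs ys → ∑ (xs ++ ys) ≈ ∑ xs + ∑ ys
  sumL-++ []       ys = sym (+-identityˡ (∑ ys))
  sumL-++ (x ∷ xs) ys = trans (+-congˡ (sumL-++ xs ys)) (sym (+-assoc x (∑ xs) (∑ ys)))

  sumL-reverse : ∀ xs → ∑ (reverse xs) ≈ ∑ xs
  sumL-reverse []       = ≈-refl
  sumL-reverse (x ∷ xs) = begin
    ∑ (reverse (x ∷ xs))       ≡⟨ cong ∑ (unfold-reverse x xs) ⟩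
    ∑ (reverse xs ∷ʳ x)        ≈⟨ sumL-++ (reverse xs) (x ∷ []) ⟩
    ∑ (reverse xs) + (x + 0#)  ≈⟨ +-cong (sumL-reverse xs) (+-identityʳ x) ⟩
    ∑ xs + x                   ≈⟨ +-comm (∑ xs) x ⟩
    x + ∑ xs                   ∎

  module _ {A : Set} where

    sumL-map-cong : ∀ {f g : A → Carrier} {xs} → All (λ x → f x ≈ g x) xs → ∑ (map f xs) ≈ ∑ (map g xs)
    sumL-map-cong []         = ≈-refl
    sumL-map-cong (fx≈gx ∷ eqs) = +-cong fx≈gx (sumL-map-cong eqs)

    sumL-map-+ : ∀ (f g : A → Carrier) xs → ∑ (map (λ x → f x + g x) xs) ≈ ∑ (map f xs) + ∑ (map g xs)
    sumL-map-+ f g []       = sym (+-identityˡ 0#)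
    sumL-map-+ f g (x ∷ xs) =
      trans (+-congˡ (sumL-map-+ f g xs)) (interchange (f x) (g x) (∑ (map f xs)) (∑ (map g xs)))

    sumL-map-*ˡ : ∀ a (f : A → Carrier) xs → ∑ (map (λ x → a * f x) xs) ≈ a * ∑ (map f xs)
    sumL-map-*ˡ a f []       = sym (zeroʳ a)
    sumL-map-*ˡ a f (x ∷ xs) = trans (+-congˡ (sumL-map-*ˡ a f xs)) (sym (distribˡ a (f x) (∑ (map f xs))))

    sumL-map-*ʳ : ∀ a (f : A → Carrier) xs → ∑ (map (λ x → f x * a) xs) ≈ ∑ (map f xs) * a
    sumL-map-*ʳ a f []       = sym (zeroˡ a)
    sumL-map-*ʳ a f (x ∷ xs) = trans (+-congˡ (sumL-map-*ʳ a f xs)) (sym (distribʳ a (f x) (∑ (map f xs))))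

    sumL-map-concatMap : ∀ {B : Set} (f : B → Carrier) (F : A → List B) xs →
      ∑ (map f (concatMap F xs)) ≈ ∑ (map (λ x → ∑ (map f (F x))) xs)
    sumL-map-concatMap f F []       = ≈-refl
    sumL-map-concatMap f F (x ∷ xs) = begin
      ∑ (map f (F x ++ concatMap F xs))               ≡⟨ cong ∑ (map-++ f (F x) (concatMap F xs)) ⟩
      ∑ (map f (F x) ++ map f (concatMap F xs))       ≈⟨ sumL-++ (map f (F x)) (map f (concatMap F xs)) ⟩
      ∑ (map f (F x)) + ∑ (map f (concatMap F xs))    ≈⟨ +-congˡ (sumL-map-concatMap f F xs) ⟩
      ∑ (map f (F x)) + ∑ (map (λ x → ∑ (map f (F x))) xs) ∎

  sumBelow : ℕ → (ℕ → Carrier) → Carrier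
  sumBelow zero    h = 0#
  sumBelow (suc m) h = h 0 + sumBelow m (h ∘ suc)

  sumL-map-upTo : ∀ m (h : ℕ → Carrier) → ∑ (map h (upTo m)) ≡ sumBelow m h
  sumL-map-upTo m h = go m id
    where
    go : ∀ m (φ : ℕ → ℕ) → ∑ (map h (applyUpTo φ m)) ≡ sumBelow m (h ∘ φ)
    go zero    φ = refl
    go (suc m) φ = cong (h (φ 0) +_) (go m (φ ∘ suc))

  sumBelow-cong : ∀ m {f g : ℕ → Carrier} → (∀ {k} → k < m → f k ≈ g k) → sumBelow m f ≈ sumBelow m g
  sumBelow-cong zero    f≈g = ≈-refl
  sumBelow-cong (suc m) f≈g = +-cong (f≈g z<s) (sumBelow-cong m (f≈g ∘ s<s))

  sumBelow-+ : ∀ m (f g : ℕ → Carrier) → sumBelow m (λ k → f k + g k) ≈ sumBelow m f + sumBelow m g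
  sumBelow-+ zero    f g = sym (+-identityˡ 0#)
  sumBelow-+ (suc m) f g =
    trans (+-congˡ (sumBelow-+ m (f ∘ suc) (g ∘ suc))) (interchange (f 0) (g 0) (sumBelow m (f ∘ suc)) (sumBelow m (g ∘ suc)))

  sumBelow-suc : ∀ m (h : ℕ → Carrier) → sumBelow (suc m) h ≈ sumBelow m h + h m
  sumBelow-suc zero    h = trans (+-identityʳ (h 0)) (sym (+-identityˡ (h 0)))
  sumBelow-suc (suc m) h = trans (+-congˡ (sumBelow-suc m (h ∘ suc))) (sym (+-assoc (h 0) _ _))

module Convolution {c ℓ} (R : CommutativeRing c ℓ) where
  open CommutativeRing R renaming (refl to ≈-refl)
  open Sums R
  open import Relation.Binary.Reasoning.Setoid setoid
  open import Algebra.Solver.Ring.NaturalCoefficients.Default commutativeSemiring using (solve; _:=_; _:+_; con)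

  -- the derivative of an exponential generating function
  shift : Series R → Series R
  shift f n = f (suc n)

  natR-+ : ∀ m n → natR R (m ℕ.+ n) ≈ natR R m + natR R n
  natR-+ zero    n = sym (+-identityˡ (natR R n))
  natR-+ (suc m) n = trans (+-congˡ (natR-+ m n)) (sym (+-assoc 1# (natR R m) (natR R n)))

  *ₑ-cong : ∀ {f f′ g g′ : Series R} → (∀ k → f k ≈ f′ k) → (∀ k → g k ≈ g′ k) →
    ∀ n → _*ₑ_ R f g n ≈ _*ₑ_ R f′ g′ n
  *ₑ-cong f≈f′ g≈g′ n =
    sumL-map-cong (All.universal (λ k → *-congˡ (*-cong (f≈f′ k) (g≈g′ (n ∸ k)))) (upTo (suc n)))

  *ₑ-zero : ∀ (f g : Series R) → _*ₑ_ R f g 0 ≈ f 0 * g 0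
  *ₑ-zero f g = trans (+-identityʳ _) (trans (*-congʳ (+-identityʳ 1#)) (*-identityˡ (f 0 * g 0)))

  *ₑ-suc : ∀ (f g : Series R) n → _*ₑ_ R f g (suc n) ≈ _*ₑ_ R (shift f) g n + _*ₑ_ R f (shift g) n
  *ₑ-suc f g n = begin
    _*ₑ_ R f g (suc n)                               ≡⟨ sumL-map-upTo (suc (suc n)) (term (suc n) f g) ⟩
    term (suc n) f g 0 + sumBelow (suc n) (term (suc n) f g ∘ suc)
      ≈⟨ +-congˡ (trans (sumBelow-cong (suc n) (λ {k} _ → pascal k)) (sumBelow-+ (suc n) X Y)) ⟩
    term (suc n) f g 0 + (sumBelow (suc n) X + sumBelow (suc n) Y)
      ≈⟨ +-congˡ (+-congˡ (trans (sumBelow-suc n Y) (+-cong (sumBelow-cong n reindex) Y-last))) ⟩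
    term (suc n) f g 0 + (sumBelow (suc n) X + (sumBelow n (term n f (shift g) ∘ suc) + 0#))
      ≈⟨ solve 3 (λ z x y → z :+ (x :+ (y :+ con 0)) := x :+ (z :+ y)) ≈-refl _ _ _ ⟩
    sumBelow (suc n) X + sumBelow (suc n) (term n f (shift g))
      ≡⟨ cong₂ _+_ (sumL-map-upTo (suc n) X) (sumL-map-upTo (suc n) (term n f (shift g))) ⟨
    _*ₑ_ R (shift f) g n + _*ₑ_ R f (shift g) n      ∎
    where
    term : ℕ → Series R → Series R → ℕ → Carrier
    term m a b k = natR R (m C k) * (a k * b (m ∸ k))
    X Y : ℕ → Carrier
    X = term n (shift f) g
    Y k = natR R (n C suc k) * (f (suc k) * g (n ∸ k))
    pascal : ∀ k → term (suc n) f g (suc k) ≈ X k + Y k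
    pascal k = begin
      natR R (suc n C suc k) * (f (suc k) * g (n ∸ k))
        ≡⟨ cong (λ m → natR R m * (f (suc k) * g (n ∸ k))) (nCk+nC[k+1]≡[n+1]C[k+1] n k) ⟨
      natR R (n C k ℕ.+ n C suc k) * (f (suc k) * g (n ∸ k))
        ≈⟨ trans (*-congʳ (natR-+ (n C k) (n C suc k))) (distribʳ _ _ _) ⟩
      X k + Y k ∎
    reindex : ∀ {k} → k < n → Y k ≈ term n f (shift g) (suc k)
    reindex {k} k<n = ≡⇒≈ (cong (λ m → natR R (n C suc k) * (f (suc k) * g m)) (+-∸-assoc 1 k<n))
    Y-last : Y n ≈ 0#
    Y-last = trans (*-congʳ (≡⇒≈ (cong (natR R) (k>n⇒nCk≡0 (n<1+n n))))) (zeroˡ _)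

module FrameSums {c ℓ} (R : CommutativeRing c ℓ) where
  open CommutativeRing R renaming (refl to ≈-refl)
  open Sums R
  open Convolution R
  open import Relation.Binary.Reasoning.Setoid setoid
  open import Algebra.Properties.CommutativeSemigroup +-commutativeSemigroup using (interchange)
  open import Algebra.Solver.Ring.NaturalCoefficients.Default commutativeSemiring using (solve; _:=_; _:+_; _:*_; con)

  permSum : (List Bool → Carrier) → Series R
  permSum h k = ∑ (map (h ∘ frame) (perms k))

  ∂ : (List Bool → Carrier) → List Bool → Carrier
  ∂ h w = ∑ (map h (peakInsertions w))

  permSum-suc : ∀ h k → permSum h (suc k) ≈ permSum (∂ h) k
  permSum-suc h k = trans (sumL-map-concatMap (h ∘ frame) (insertions (suc k)) (perms k))
                          (sumL-map-cong (All.map insert-max (perms-wellFormed k)))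
    where
    insert-max : ∀ {σ} → WellFormed k σ → ∑ (map (h ∘ frame) (insertions (suc k) σ)) ≈ ∂ h (frame σ)
    insert-max {σ} (_ , bounded , _) =
      ≡⇒≈ (≡.trans (cong ∑ (map-∘ (insertions (suc k) σ))) (cong (∑ ∘ map h) (frame-insertions bounded)))

  permSum-cong : ∀ {f g} → (∀ w → f w ≈ g w) → ∀ k → permSum f k ≈ permSum g k
  permSum-cong f≈g k = sumL-map-cong (All.universal (f≈g ∘ frame) (perms k))

  -- cutSum F w sums F (u ∷ʳ false) (suffixFrame v) over w = u ++ x ∷ v; for w = frame σ these
  -- are the frames of the two factors of each cut σ = σ′σ″.
  cutSum : (List Bool → List Bool → Carrier) → List Bool → Carrier
  cutSum F []      = 0#
  cutSum F (x ∷ w) = F (false ∷ []) (suffixFrame w) + cutSum (λ u → F (x ∷ u)) w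

  infixl 7 _⊛_
  _⊛_ : (f g : List Bool → Carrier) → List Bool → Carrier
  f ⊛ g = cutSum (λ u v → f u * g v)

  cutSum-cong : ∀ {F G} → (∀ u v → F u v ≈ G u v) → ∀ w → cutSum F w ≈ cutSum G w
  cutSum-cong F≈G []      = ≈-refl
  cutSum-cong F≈G (x ∷ w) = +-cong (F≈G _ _) (cutSum-cong (λ u → F≈G (x ∷ u)) w)

  cutSum-+ : ∀ F G w → cutSum (λ u v → F u v + G u v) w ≈ cutSum F w + cutSum G w
  cutSum-+ F G []      = sym (+-identityˡ 0#)
  cutSum-+ F G (x ∷ w) = trans (+-congˡ (cutSum-+ (λ u → F (x ∷ u)) (λ u → G (x ∷ u)) w))
                               (interchange _ _ _ _)

  -- ∂ acts on cut sums as a derivation: a peak inserted into w lies in the left or the right part of a cut.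
  ∂-cutSum : ∀ F w → ∂ (cutSum F) w ≈ cutSum (λ u v → ∂ (λ u′ → F u′ v) u + ∂ (F u) v) w
  ∂-cutSum F []      = ≈-refl
  ∂-cutSum F (x ∷ w) = begin
    (A + (B + E)) + ∑ (map (cutSum F) (map (x ∷_) (peakInsertions w)))
      ≡⟨ cong (λ s → (A + (B + E)) + ∑ s) (map-∘ (peakInsertions w)) ⟨
    (A + (B + E)) + ∑ (map (λ w′ → F (false ∷ []) (suffixFrame w′) + cutSum Fₓ w′) (peakInsertions w))
      ≈⟨ +-congˡ (trans (sumL-map-+ (F (false ∷ []) ∘ suffixFrame) (cutSum Fₓ) (peakInsertions w))
                        (+-congˡ (∂-cutSum Fₓ w))) ⟩
    (A + (B + E)) + (D + cutSum Gₓ w)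
      ≈⟨ solve 5 (λ a b c d i → (a :+ (b :+ c)) :+ (d :+ i) := ((b :+ con 0) :+ (a :+ d)) :+ (c :+ i))
                 ≈-refl A B E D (cutSum Gₓ w) ⟩
    ((B + 0#) + (A + D)) + (E + cutSum Gₓ w)
      ≈⟨ +-cong (+-congˡ right-peaks) (sym (trans (cutSum-cong (λ u v → left-peaks u v) w) (cutSum-+ _ Gₓ w))) ⟩
    cutSum G (x ∷ w) ∎
    where
    Fₓ : List Bool → List Bool → Carrier
    Fₓ u = F (x ∷ u)
    G Gₓ : List Bool → List Bool → Carrier
    G u v = ∂ (λ u′ → F u′ v) u + ∂ (F u) v
    Gₓ u v = ∂ (λ u′ → Fₓ u′ v) u + ∂ (Fₓ u) v
    A B E D : Carrier
    A = F (false ∷ []) (suffixFrame (false ∷ w))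
    B = F (true ∷ false ∷ []) (suffixFrame w)
    E = cutSum (λ u → F (true ∷ false ∷ u)) w
    D = ∑ (map (F (false ∷ []) ∘ suffixFrame) (peakInsertions w))
    right-peaks : A + D ≈ ∂ (F (false ∷ [])) (suffixFrame w)
    right-peaks = ≡⇒≈ (≡.sym (≡.trans (cong (∑ ∘ map (F (false ∷ []))) (peakInsertions-suffixFrame w))
                                     (cong (λ s → A + ∑ s) (≡.sym (map-∘ (peakInsertions w))))))
    left-peaks : ∀ u v → G (x ∷ u) v ≈ F (true ∷ false ∷ u) v + Gₓ u v
    left-peaks u v = begin
      (F (true ∷ false ∷ u) v + ∑ (map (λ u′ → F u′ v) (map (x ∷_) (peakInsertions u)))) + ∂ (Fₓ u) v
        ≡⟨ cong (λ s → (F (true ∷ false ∷ u) v + ∑ s) + ∂ (Fₓ u) v) (map-∘ (peakInsertions u)) ⟨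
      (F (true ∷ false ∷ u) v + ∂ (λ u′ → Fₓ u′ v) u) + ∂ (Fₓ u) v
        ≈⟨ +-assoc _ _ _ ⟩
      F (true ∷ false ∷ u) v + Gₓ u v ∎

  ∂-⊛ : ∀ f g w → ∂ (f ⊛ g) w ≈ (∂ f ⊛ g) w + (f ⊛ ∂ g) w
  ∂-⊛ f g w = begin
    ∂ (f ⊛ g) w                                                       ≈⟨ ∂-cutSum (λ u v → f u * g v) w ⟩
    cutSum (λ u v → ∂ (λ u′ → f u′ * g v) u + ∂ (λ v′ → f u * g v′) v) w
      ≈⟨ cutSum-cong (λ u v → +-cong (sumL-map-*ʳ (g v) f (peakInsertions u)) (sumL-map-*ˡ (f u) g (peakInsertions v))) w ⟩
    cutSum (λ u v → ∂ f u * g v + f u * ∂ g v) w                       ≈⟨ cutSum-+ _ _ w ⟩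
    (∂ f ⊛ g) w + (f ⊛ ∂ g) w                                          ∎

  permSum-⊛ : ∀ f g n → _*ₑ_ R (permSum f) (permSum g) n ≈ permSum (f ⊛ g) n
  permSum-⊛ f g zero    = trans (*ₑ-zero (permSum f) (permSum g))
    (solve 2 (λ a b → (a :+ con 0) :* (b :+ con 0) := (a :* b :+ con 0) :+ con 0) ≈-refl (f (false ∷ [])) (g (false ∷ [])))
  permSum-⊛ f g (suc n) = begin
    _*ₑ_ R (permSum f) (permSum g) (suc n)
      ≈⟨ *ₑ-suc (permSum f) (permSum g) n ⟩
    _*ₑ_ R (shift (permSum f)) (permSum g) n + _*ₑ_ R (permSum f) (shift (permSum g)) n
      ≈⟨ +-cong (*ₑ-cong {g = permSum g} (permSum-suc f) (λ _ → ≈-refl) n)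
                (*ₑ-cong {f = permSum f} (λ _ → ≈-refl) (permSum-suc g) n) ⟩
    _*ₑ_ R (permSum (∂ f)) (permSum g) n + _*ₑ_ R (permSum f) (permSum (∂ g)) n
      ≈⟨ +-cong (permSum-⊛ (∂ f) g n) (permSum-⊛ f (∂ g) n) ⟩
    permSum (∂ f ⊛ g) n + permSum (f ⊛ ∂ g) n
      ≈⟨ sumL-map-+ ((∂ f ⊛ g) ∘ frame) ((f ⊛ ∂ g) ∘ frame) (perms n) ⟨
    permSum (λ w → (∂ f ⊛ g) w + (f ⊛ ∂ g) w) n
      ≈⟨ permSum-cong (λ w → ∂-⊛ f g w) n ⟨
    permSum (∂ (f ⊛ g)) n
      ≈⟨ permSum-suc (f ⊛ g) n ⟨
    permSum (f ⊛ g) (suc n) ∎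

  ∂-mirror : ∀ h w → ∂ (h ∘ mirror) w ≈ ∂ h (mirror w)
  ∂-mirror h w = begin
    ∑ (map (h ∘ mirror) (peakInsertions w))                 ≡⟨ cong ∑ (map-∘ (peakInsertions w)) ⟩
    ∑ (map h (map mirror (peakInsertions w)))               ≡⟨ cong (∑ ∘ map h) (map-mirror-peakInsertions w) ⟩
    ∑ (map h (reverse (peakInsertions (mirror w))))         ≡⟨ cong ∑ (reverse-map h (peakInsertions (mirror w))) ⟩
    ∑ (reverse (map h (peakInsertions (mirror w))))         ≈⟨ sumL-reverse (map h (peakInsertions (mirror w))) ⟩
    ∑ (map h (peakInsertions (mirror w)))                   ∎

  -- mirror (frame []) is not frame [], hence suc k.
  permSum-mirror : ∀ h k → permSum (h ∘ mirror) (suc k) ≈ permSum h (suc k)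
  permSum-mirror h zero    = ≈-refl
  permSum-mirror h (suc k) = begin
    permSum (h ∘ mirror) (suc (suc k))  ≈⟨ permSum-suc (h ∘ mirror) (suc k) ⟩
    permSum (∂ (h ∘ mirror)) (suc k)    ≈⟨ permSum-cong (∂-mirror h) (suc k) ⟩
    permSum (∂ h ∘ mirror) (suc k)      ≈⟨ permSum-mirror (∂ h) k ⟩
    permSum (∂ h) (suc k)               ≈⟨ permSum-suc h (suc k) ⟨
    permSum h (suc (suc k))             ∎

module BallotCuts {c ℓ} (R : CommutativeRing c ℓ) (y t t⁻¹ : CommutativeRing.Carrier R)
                  (t*t⁻¹≈1 : CommutativeRing._≈_ R (CommutativeRing._*_ R t t⁻¹) (CommutativeRing.1# R)) where
  open CommutativeRing R renaming (refl to ≈-refl)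
  open Sums R
  open FrameSums R
  open import Relation.Binary.Reasoning.Setoid setoid
  open import Algebra.Solver.Ring.NaturalCoefficients.Default commutativeSemiring using (solve; _:=_; _:+_; _:*_; con)

  infixr 8 _^_
  _^_ : Carrier → ℕ → Carrier
  _^_ = pow R

  ^-+ : ∀ a m n → a ^ (m ℕ.+ n) ≈ a ^ m * a ^ n
  ^-+ a zero    n = sym (*-identityˡ (a ^ n))
  ^-+ a (suc m) n = trans (*-congˡ (^-+ a m n)) (sym (*-assoc a (a ^ m) (a ^ n)))

  t^n*t⁻¹^n≈1 : ∀ n → t ^ n * t⁻¹ ^ n ≈ 1#
  t^n*t⁻¹^n≈1 zero    = *-identityˡ 1#
  t^n*t⁻¹^n≈1 (suc n) = begin
    (t * t ^ n) * (t⁻¹ * t⁻¹ ^ n) ≈⟨ interchange t (t ^ n) t⁻¹ (t⁻¹ ^ n) ⟩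
    (t * t⁻¹) * (t ^ n * t⁻¹ ^ n) ≈⟨ *-cong t*t⁻¹≈1 (t^n*t⁻¹^n≈1 n) ⟩
    1# * 1#                       ≈⟨ *-identityˡ 1# ⟩
    1#                            ∎
    where open import Algebra.Properties.CommutativeSemigroup *-commutativeSemigroup using (interchange)

  𝟙 : Bool → Carrier
  𝟙 true  = 1#
  𝟙 false = 0#

  if≈𝟙* : ∀ b x → (if b then x else 0#) ≈ 𝟙 b * x
  if≈𝟙* true  x = sym (*-identityˡ x)
  if≈𝟙* false x = sym (zeroˡ x)

  monomial : Carrier → List Bool → Carrier
  monomial τ s = y ^ peaks s * τ ^ downs s

  ballotWeight : Carrier → List Bool → Carrier
  ballotWeight τ s = if ballot 0 s then monomial τ s else 0#

  ballotTerm : Carrier → List ℕ → Carrier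
  ballotTerm τ σ = if isBallot σ then weight R y τ σ else 0#

  ballotWeight-steps : ∀ τ {a σ} → Linked _≢_ (a ∷ σ) → ballotWeight τ (steps a σ) ≡ ballotTerm τ (a ∷ σ)
  ballotWeight-steps τ linked rewrite isBallot-steps linked | pk-steps linked | des-steps linked = refl

  -- The summands of B(xt, y, 1/t) and of B(x, y, t), read off the frame of a permutation.
  leftFactor rightFactor : List Bool → Carrier
  leftFactor []      = 0#
  leftFactor (_ ∷ w) = t ^ length w * ballotWeight t⁻¹ (dropLast w)
  rightFactor []      = 0#
  rightFactor (_ ∷ w) = ballotWeight t (dropLast w)

  leftFactor-frame : ∀ {k σ} → WellFormed k σ → leftFactor (frame σ) ≡ t ^ k * ballotTerm t⁻¹ σ
  leftFactor-frame {σ = []}    (refl , _ , _)      = refl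
  leftFactor-frame {σ = a ∷ σ} (refl , _ , linked)
    rewrite length-∷ʳ (steps a σ) false | length-steps a σ | dropLast-∷ʳ (steps a σ) false
    = cong (t ^ suc (length σ) *_) (ballotWeight-steps t⁻¹ linked)

  rightFactor-frame : ∀ {σ} → Linked _≢_ σ → rightFactor (frame σ) ≡ ballotTerm t σ
  rightFactor-frame {[]}    _      = refl
  rightFactor-frame {a ∷ σ} linked rewrite dropLast-∷ʳ (steps a σ) false = ballotWeight-steps t linked

  Bser≈permSum : ∀ k → Bser R y t k ≈ permSum rightFactor k
  Bser≈permSum k =
    sumL-map-cong (All.map (λ (_ , _ , linked) → ≡⇒≈ (≡.sym (rightFactor-frame linked))) (perms-wellFormed k))

  scaledBser≈permSum : ∀ k → scaleX R t (Bser R y t⁻¹) k ≈ permSum (leftFactor ∘ mirror) k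
  scaledBser≈permSum k = begin
    t ^ k * Bser R y t⁻¹ k
      ≈⟨ sumL-map-*ˡ (t ^ k) (ballotTerm t⁻¹) (perms k) ⟨
    ∑ (map (λ σ → t ^ k * ballotTerm t⁻¹ σ) (perms k))
      ≈⟨ sumL-map-cong (All.map (λ wf → ≡⇒≈ (≡.sym (leftFactor-frame wf))) (perms-wellFormed k)) ⟩
    permSum leftFactor k
      ≈⟨ mirror-invariant k ⟨
    permSum (leftFactor ∘ mirror) k ∎
    where
    mirror-invariant : ∀ k → permSum (leftFactor ∘ mirror) k ≈ permSum leftFactor k
    mirror-invariant zero    = ≈-refl
    mirror-invariant (suc k) = permSum-mirror leftFactor k

  monomial-++ : ∀ τ p v → height p ≡ 0 → monomial τ (p ++ v) ≈ monomial τ p * monomial τ v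
  monomial-++ τ p v grounded = begin
    y ^ peaks (p ++ v) * τ ^ downs (p ++ v)
      ≡⟨ cong₂ (λ m n → y ^ m * τ ^ n) (peaks-++-grounded p v grounded) (downs-++ p v) ⟩
    y ^ (peaks p ℕ.+ peaks v) * τ ^ (downs p ℕ.+ downs v)
      ≈⟨ *-cong (^-+ y (peaks p) (peaks v)) (^-+ τ (downs p) (downs v)) ⟩
    (y ^ peaks p * y ^ peaks v) * (τ ^ downs p * τ ^ downs v)
      ≈⟨ interchange (y ^ peaks p) (y ^ peaks v) (τ ^ downs p) (τ ^ downs v) ⟩
    monomial τ p * monomial τ v ∎
    where open import Algebra.Properties.CommutativeSemigroup *-commutativeSemigroup using (interchange)

  monomial-↑∷ : ∀ τ s → ballot 0 s ≡ true → monomial τ (true ∷ s) ≡ monomial τ s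
  monomial-↑∷ τ s isBallot = cong (λ m → y ^ m * τ ^ downs s) (peaks-↑∷ballot s isBallot)

  monomial-↓∷ : ∀ τ s → monomial τ (false ∷ s) ≈ τ * monomial τ s
  monomial-↓∷ τ s = x∙yz≈y∙xz (y ^ peaks s) τ (τ ^ downs s)
    where open import Algebra.Properties.CommutativeSemigroup *-commutativeSemigroup using (x∙yz≈y∙xz)

  ballotWeight-mirror : ∀ τ p → ballotWeight τ (mirror p) ≡ (if height p ≤ᵇ 0 then y ^ peaks p * τ ^ ups p else 0#)
  ballotWeight-mirror τ p rewrite ballot-mirror 0 p | peaks-mirror p | downs-mirror p = refl

  leftFactor-mirror : ∀ x p → leftFactor (mirror (x ∷ p ∷ʳ false)) ≈ 𝟙 (height p ≤ᵇ 0) * (t * monomial t p)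
  leftFactor-mirror x p = begin
    leftFactor (mirror (x ∷ p ∷ʳ false))
      ≡⟨ cong leftFactor (≡.trans (mirror-∷ x (p ∷ʳ false)) (cong (_∷ʳ not x) (mirror-∷ʳ p false))) ⟩
    t ^ length (mirror p ∷ʳ not x) * ballotWeight t⁻¹ (dropLast (mirror p ∷ʳ not x))
      ≡⟨ cong₂ (λ n w → t ^ n * ballotWeight t⁻¹ w) (≡.trans (length-∷ʳ (mirror p) (not x)) (cong suc length-mirror))
                                                     (dropLast-∷ʳ (mirror p) (not x)) ⟩
    t ^ suc (U ℕ.+ D) * ballotWeight t⁻¹ (mirror p)
      ≈⟨ *-cong (*-congˡ (^-+ t U D)) (trans (≡⇒≈ (ballotWeight-mirror t⁻¹ p)) (if≈𝟙* _ _)) ⟩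
    (t * (t ^ U * t ^ D)) * (𝟙 B * (Y * t⁻¹ ^ U))
      ≈⟨ solve 6 (λ t a d i Y b → (t :* (a :* d)) :* (i :* (Y :* b)) := (a :* b) :* (i :* (t :* (Y :* d))))
               ≈-refl t (t ^ U) (t ^ D) (𝟙 B) Y (t⁻¹ ^ U) ⟩
    (t ^ U * t⁻¹ ^ U) * (𝟙 B * (t * monomial t p))
      ≈⟨ trans (*-congʳ (t^n*t⁻¹^n≈1 U)) (*-identityˡ _) ⟩
    𝟙 B * (t * monomial t p) ∎
    where
    U D : ℕ
    U = ups p
    D = downs p
    B : Bool
    B = height p ≤ᵇ 0
    Y : Carrier
    Y = y ^ peaks p
    length-mirror : length (mirror p) ≡ U ℕ.+ D
    length-mirror = ≡.trans (length-reverse (map not p)) (≡.trans (length-map not p) (length≡ups+downs p))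

  rightFactor-suffixFrame : ∀ s z → rightFactor (suffixFrame (s ∷ʳ z)) ≈ 𝟙 (ballot 0 s) * monomial t s
  rightFactor-suffixFrame s z rewrite suffixFrame-∷ʳ s z | dropLast-∷ʳ s z = if≈𝟙* (ballot 0 s) (monomial t s)

  -- The cuts of x ∷ p ++ q that fall inside q.
  tailCuts : Bool → List Bool → List Bool → Carrier
  tailCuts x p = cutSum (λ u v → leftFactor (mirror (x ∷ p ++ u)) * rightFactor v)

  tailCuts-∷ : ∀ x p b q →
    tailCuts x p (b ∷ q) ≈ leftFactor (mirror (x ∷ p ∷ʳ false)) * rightFactor (suffixFrame q) + tailCuts x (p ∷ʳ b) q
  tailCuts-∷ x p b q =
    +-congˡ (cutSum-cong (λ u v → ≡⇒≈ (cong (λ w → leftFactor (mirror (x ∷ w)) * rightFactor v)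
                                          (≡.sym (∷ʳ-++ p b u)))) q)

  -- Seen from height h, exactly one later cut has weight 1 (the one after the last descent absorbed at 0,
  -- if any) and one has weight t (the one at the last visit to 0, if any).
  pending : ℕ → List Bool → Carrier
  pending h s = 𝟙 (not (ballot h s)) + t * 𝟙 (touchesZero h s)

  0*a*b+x≈x : ∀ a b x → 0# * a * b + x ≈ x
  0*a*b+x≈x a b x = trans (+-congʳ (trans (*-congʳ (zeroˡ a)) (zeroˡ b))) (+-identityˡ x)

  cut-step : ∀ p b s {h} → height p ≡ h →
    𝟙 (h ≤ᵇ 0) * (t * monomial t p) * (𝟙 (ballot 0 s) * monomial t s) + monomial t (p ++ b ∷ s) * pending (climb h b) s
      ≈ monomial t (p ++ b ∷ s) * pending h (b ∷ s)
  cut-step p true  s {suc h}       _ = 0*a*b+x≈x _ _ _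
  cut-step p false s {suc zero}    _ = 0*a*b+x≈x _ _ _
  cut-step p false s {suc (suc h)} _ = 0*a*b+x≈x _ _ _
  cut-step p true  s {zero} grounded with ballot 0 s in isBallot
  ... | true  = trans (+-congʳ (trans (solve 3 (λ t a b → (con 1 :* (t :* a)) :* (con 1 :* b) := t :* (a :* b)) ≈-refl t Mp Ms)
                                      (*-congˡ (sym joined))))
                      (solve 3 (λ t m x → t :* m :+ m :* (x :+ t :* con 0) := m :* (x :+ t :* con 1)) ≈-refl t M _)
    where
    Mp Ms M : Carrier
    Mp = monomial t p
    Ms = monomial t s
    M  = monomial t (p ++ true ∷ s)
    joined : M ≈ Mp * Ms
    joined = trans (monomial-++ t p (true ∷ s) grounded) (*-congˡ (≡⇒≈ (monomial-↑∷ t s isBallot)))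
  ... | false = solve 5 (λ t a b m x → (con 1 :* (t :* a)) :* (con 0 :* b) :+ m :* (x :+ t :* con 1) := m :* (x :+ t :* con 1))
                      ≈-refl t (monomial t p) (monomial t s) (monomial t (p ++ true ∷ s)) _
  cut-step p false s {zero} grounded with ballot 0 s
  ... | true  = trans (+-congʳ (trans (solve 3 (λ t a b → (con 1 :* (t :* a)) :* (con 1 :* b) := (t :* a) :* b) ≈-refl t Mp Ms)
                                      (sym joined)))
                      (solve 2 (λ t m → m :+ m :* (con 0 :+ t :* con 1) := m :* (con 1 :+ t :* con 1)) ≈-refl t M)
    where
    Mp Ms M : Carrier
    Mp = monomial t p
    Ms = monomial t s
    M  = monomial t (p ++ false ∷ s)
    joined : M ≈ t * Mp * Ms
    joined = begin
      M                       ≈⟨ monomial-++ t p (false ∷ s) grounded ⟩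
      Mp * monomial t (false ∷ s) ≈⟨ *-congˡ (monomial-↓∷ t s) ⟩
      Mp * (t * Ms)           ≈⟨ solve 3 (λ t a b → a :* (t :* b) := t :* a :* b) ≈-refl t Mp Ms ⟩
      t * Mp * Ms             ∎
  ... | false = solve 4 (λ t a b m → (con 1 :* (t :* a)) :* (con 0 :* b) :+ m :* (con 1 :+ t :* con 1) := m :* (con 1 :+ t :* con 1))
                      ≈-refl t (monomial t p) (monomial t s) (monomial t (p ++ false ∷ s))

  tailCuts-∷ʳ : ∀ x s z p → tailCuts x p (s ∷ʳ z) ≈ monomial t (p ++ s) * pending (height p) s
  tailCuts-∷ʳ x [] z p = begin
    leftFactor (mirror (x ∷ p ∷ʳ false)) * (1# * 1#) + 0#
      ≈⟨ +-congʳ (*-congʳ (leftFactor-mirror x p)) ⟩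
    𝟙 (height p ≤ᵇ 0) * (t * monomial t p) * (1# * 1#) + 0#
      ≈⟨ solve 3 (λ i t m → i :* (t :* m) :* (con 1 :* con 1) :+ con 0 := m :* (con 0 :+ t :* i)) ≈-refl _ t (monomial t p) ⟩
    monomial t p * (0# + t * 𝟙 (height p ≤ᵇ 0))
      ≡⟨ cong₂ (λ w b → monomial t w * (0# + t * 𝟙 b)) (≡.sym (++-identityʳ p)) (≡.sym (touchesZero-[] (height p))) ⟩
    monomial t (p ++ []) * pending (height p) [] ∎
    where
    touchesZero-[] : ∀ h → touchesZero h [] ≡ (h ≤ᵇ 0)
    touchesZero-[] zero    = refl
    touchesZero-[] (suc h) = refl
  tailCuts-∷ʳ x (b ∷ s) z p = begin
    tailCuts x p (b ∷ s ∷ʳ z)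
      ≈⟨ tailCuts-∷ x p b (s ∷ʳ z) ⟩
    leftFactor (mirror (x ∷ p ∷ʳ false)) * rightFactor (suffixFrame (s ∷ʳ z)) + tailCuts x (p ∷ʳ b) (s ∷ʳ z)
      ≈⟨ +-cong (*-cong (leftFactor-mirror x p) (rightFactor-suffixFrame s z)) (tailCuts-∷ʳ x s z (p ∷ʳ b)) ⟩
    𝟙 (height p ≤ᵇ 0) * (t * monomial t p) * (𝟙 (ballot 0 s) * monomial t s)
      + monomial t ((p ∷ʳ b) ++ s) * pending (height (p ∷ʳ b)) s
      ≡⟨ cong₂ (λ w h → _ + monomial t w * pending h s) (∷ʳ-++ p b s) (height-∷ʳ p b) ⟩
    𝟙 (height p ≤ᵇ 0) * (t * monomial t p) * (𝟙 (ballot 0 s) * monomial t s)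
      + monomial t (p ++ b ∷ s) * pending (climb (height p) b) s
      ≈⟨ cut-step p b s refl ⟩
    monomial t (p ++ b ∷ s) * pending (height p) (b ∷ s) ∎

  cut-identity : ∀ x s z → (leftFactor ∘ mirror ⊛ rightFactor) (x ∷ s ∷ʳ z) ≈ (1# + t) * monomial t s
  cut-identity x s z = begin
    (1# * (1# * 1#)) * rightFactor (suffixFrame (s ∷ʳ z)) + tailCuts x [] (s ∷ʳ z)
      ≈⟨ +-cong (*-congˡ (rightFactor-suffixFrame s z)) (tailCuts-∷ʳ x s z []) ⟩
    (1# * (1# * 1#)) * (𝟙 (ballot 0 s) * monomial t s) + monomial t s * (𝟙 (not (ballot 0 s)) + t * 1#)
      ≈⟨ both-cases (ballot 0 s) ⟩
    (1# + t) * monomial t s ∎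
    where
    both-cases : ∀ b → (1# * (1# * 1#)) * (𝟙 b * monomial t s) + monomial t s * (𝟙 (not b) + t * 1#) ≈ (1# + t) * monomial t s
    both-cases true  = solve 2 (λ t m → (con 1 :* (con 1 :* con 1)) :* (con 1 :* m) :+ m :* (con 0 :+ t :* con 1) := (con 1 :+ t) :* m)
                             ≈-refl t (monomial t s)
    both-cases false = solve 2 (λ t m → (con 1 :* (con 1 :* con 1)) :* (con 0 :* m) :+ m :* (con 1 :+ t :* con 1) := (con 1 :+ t) :* m)
                             ≈-refl t (monomial t s)

  permSum-cuts : ∀ n → permSum (leftFactor ∘ mirror ⊛ rightFactor) n ≈ _-ₛ_ R (_·ₛ_ R (1# + t) (Pser R y t)) (constS R t) n
  permSum-cuts zero    = begin
    ((1# * (1# * 1#)) * (1# * 1#) + 0#) + 0#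
      ≈⟨ solve 0 (((con 1 :* (con 1 :* con 1)) :* (con 1 :* con 1) :+ con 0) :+ con 0 := con 1) ≈-refl ⟩
    1#                                   ≈⟨ +-identityʳ 1# ⟨
    1# + 0#                              ≈⟨ +-congˡ (-‿inverseʳ t) ⟨
    1# + (t - t)                         ≈⟨ +-assoc 1# t (- t) ⟨
    (1# + t) - t                         ≈⟨ +-congʳ (trans (*-congˡ (trans (+-identityʳ _) (*-identityˡ 1#))) (*-identityʳ _)) ⟨
    (1# + t) * (1# * 1# + 0#) - t        ∎
  permSum-cuts (suc n) = begin
    permSum (leftFactor ∘ mirror ⊛ rightFactor) (suc n)
      ≈⟨ sumL-map-cong (All.map cuts-of-frame (perms-wellFormed (suc n))) ⟩
    ∑ (map (λ σ → (1# + t) * weight R y t σ) (perms (suc n)))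
      ≈⟨ sumL-map-*ˡ (1# + t) (weight R y t) (perms (suc n)) ⟩
    (1# + t) * Pser R y t (suc n)
      ≈⟨ +-identityʳ _ ⟨
    (1# + t) * Pser R y t (suc n) + 0#
      ≈⟨ +-congˡ ε⁻¹≈ε ⟨
    (1# + t) * Pser R y t (suc n) - 0# ∎
    where
    open import Algebra.Properties.AbelianGroup +-abelianGroup using (ε⁻¹≈ε)
    cuts-of-frame : ∀ {σ} → WellFormed (suc n) σ →
      (leftFactor ∘ mirror ⊛ rightFactor) (frame σ) ≈ (1# + t) * weight R y t σ
    cuts-of-frame {a ∷ σ} (_ , _ , linked) =
      trans (cut-identity (0 <ᵇ a) (steps a σ) false)
            (*-congˡ (≡⇒≈ (cong₂ (λ m n → y ^ m * t ^ n) (≡.sym (pk-steps linked)) (≡.sym (des-steps linked)))))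

theorem3p3 : ∀ {c ℓ} (R : CommutativeRing c ℓ) (y t t⁻¹ : CommutativeRing.Carrier R) →
    CommutativeRing._≈_ R (CommutativeRing._*_ R t t⁻¹) (CommutativeRing.1# R) →
    (n : ℕ) →
    CommutativeRing._≈_ R
      (_*ₑ_ R (scaleX R t (Bser R y t⁻¹)) (Bser R y t) n)
      (_-ₛ_ R (_·ₛ_ R (CommutativeRing._+_ R (CommutativeRing.1# R) t) (Pser R y t)) (constS R t) n)
theorem3p3 R y t t⁻¹ t*t⁻¹≈1 n = begin
  _*ₑ_ R (scaleX R t (Bser R y t⁻¹)) (Bser R y t) n              ≈⟨ *ₑ-cong scaledBser≈permSum Bser≈permSum n ⟩
  _*ₑ_ R (permSum (leftFactor ∘ mirror)) (permSum rightFactor) n ≈⟨ permSum-⊛ (leftFactor ∘ mirror) rightFactor n ⟩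
  permSum (leftFactor ∘ mirror ⊛ rightFactor) n                  ≈⟨ permSum-cuts n ⟩
  _-ₛ_ R (_·ₛ_ R (1# + t) (Pser R y t)) (constS R t) n           ∎
  where
  open CommutativeRing R
  open import Relation.Binary.Reasoning.Setoid setoid
  open Convolution R using (*ₑ-cong)
  open FrameSums R using (permSum; permSum-⊛; _⊛_)
  open BallotCuts R y t t⁻¹ t*t⁻¹≈1
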